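{- Let $n\ge2$, let $S,T$ be nonempty subsets of $\{1,\ldots,n-1\}$, let $D$ be the digraph of $T_n\langle S;T\rangle$, and let $m$ be a positive integer. If two vertices $u$ and $v$ are adjacent in $C^m(D)$, then $u-v$ is a multiple of $\gcd\{s+t\mid s\in S,\ t\in T\}$.
   Context: $T_n\langle S;T\rangle$ is the $n\times n$ $(0,1)$-matrix whose $(i,j)$-entry is $1$ iff $j-i\in S$ or $i-j\in T$; its digraph $D$ has vertex set $[n]$ and an arc $(i,j)$ iff that entry is $1$. The $m$-step competition graph $C^m(D)$ has vertex set $[n]$, with distinct $u,v$ adjacent iff there is a vertex $w$ with a directed $(u,w)$-walk of length $m$ and a directed $(v,w)$-walk of length $m$ in $D$. -}

module Defs where

open import Data.Nat using (ℕ; zero; suc; _≤_; _<_; _∸_; _+_)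
open import Data.Nat.Divisibility using (_∣_)
open import Data.Product using (_×_; ∃)
open import Data.Sum using (_⊎_)
open import Relation.Binary.PropositionalEquality using (_≢_)

Vertex : ℕ → ℕ → Set
Vertex n i = 1 ≤ i × i ≤ n

-- Arc (i,j) of the digraph of T_n⟨S;T⟩: entry (i,j) is 1 iff j-i ∈ S or i-j ∈ T
-- (differences taken in ℤ; a positive difference is written with ∸ and an
-- explicit strict inequality).
Arc : ℕ → (ℕ → Set) → (ℕ → Set) → ℕ → ℕ → Set
Arc n S T i j =
  Vertex n i × Vertex n j ×
  ((i < j × S (j ∸ i)) ⊎ (j < i × T (i ∸ j)))

data Walk (n : ℕ) (S T : ℕ → Set) : ℕ → ℕ → ℕ → Set where
  here : ∀ {u} → Vertex n u → Walk n S T zero u u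
  step : ∀ {m u x w} → Arc n S T u x → Walk n S T m x w → Walk n S T (suc m) u w

CompAdj : ℕ → (ℕ → Set) → (ℕ → Set) → ℕ → ℕ → ℕ → Set
CompAdj n S T m u v =
  Vertex n u × Vertex n v × u ≢ v ×
  ∃ λ w → Walk n S T m u w × Walk n S T m v w

IsGcdOfSums : (ℕ → Set) → (ℕ → Set) → ℕ → Set
IsGcdOfSums S T g =
  (∀ s t → S s → T t → g ∣ (s + t)) ×
  (∀ d → (∀ s t → S s → T t → d ∣ (s + t)) → d ∣ g)

-- Fix t₀ ∈ T and write g for the gcd. Every s ∈ S is ≡ -t₀ and every t ∈ T is
-- ≡ t₀ (mod g), since s + t ≡ 0 ≡ s + t₀. Hence each arc of D, whether it goes
-- forward by some s or backward by some t, lowers its tail by t₀ modulo g, and a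
-- walk of length m from u ends at w ≡ u - m t₀. Two vertices with a common
-- m-step prey w are therefore both ≡ w + m t₀, i.e. congruent modulo g.
module Submission where

open import Defs
open import Data.Nat using (ℕ; _≤_; _<_; _∸_; ∣_-_∣)
open import Data.Nat.Divisibility using (_∣_)
open import Data.Product using (_×_; ∃)

open import Data.Nat using (suc; _+_; _*_)
open import Data.Nat.Properties
  using (+-identityʳ; +-assoc; +-comm; m+[n∸m]≡n; <⇒≤; ≤-total; m≤n⇒∣m-n∣≡n∸m; ∣-∣-comm)
open import Data.Nat.Divisibility using (_∣0)
open import Data.Integer as ℤ using (+_)
open import Data.Integer.Properties using (+-inverseʳ; [+m]-[+n]≡m⊖n; ∣⊖∣-≤; ∣m⊖n∣≡∣n⊖m∣)
open import Data.Integer.Divisibility.Signed as Signed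
  using (∣ᵤ⇒∣; ∣⇒∣ᵤ; ∣m⇒∣-m; ∣m∣n⇒∣m+n)
open import Data.Integer.Tactic.RingSolver using (solve-∀)
open import Data.Product using (_,_)
open import Data.Sum using (inj₁; inj₂)
open import Relation.Binary.Bundles using (Setoid)
open import Relation.Binary.PropositionalEquality using (_≡_; sym; trans; cong; subst)
import Relation.Binary.Reasoning.Setoid as SetoidReasoning

infix 4 _≡_mod_

-- A record rather than a synonym, so that a and b can be inferred from a proof.
record _≡_mod_ (a b g : ℕ) : Set where
  constructor divides-difference
  field difference-divisible : + g Signed.∣ + a ℤ.- + b

∣⊖∣≡∣-∣ : ∀ a b → ℤ.∣ a ℤ.⊖ b ∣ ≡ ∣ a - b ∣
∣⊖∣≡∣-∣ a b with ≤-total a b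
... | inj₁ a≤b = trans (∣⊖∣-≤ a≤b) (sym (m≤n⇒∣m-n∣≡n∸m a≤b))
... | inj₂ b≤a = trans (∣m⊖n∣≡∣n⊖m∣ a b)
                   (trans (∣⊖∣-≤ b≤a) (trans (sym (m≤n⇒∣m-n∣≡n∸m b≤a)) (∣-∣-comm b a)))

module _ {g : ℕ} where

  private
    from-divisible : ∀ {i a b} → i ≡ + a ℤ.- + b → + g Signed.∣ i → a ≡ b mod g
    from-divisible i≡a-b g∣i = divides-difference (subst (+ g Signed.∣_) i≡a-b g∣i)

  ≡-mod-refl : ∀ {a} → a ≡ a mod g
  ≡-mod-refl {a} = from-divisible (sym (+-inverseʳ (+ a))) (∣ᵤ⇒∣ (g ∣0))

  ≡-mod-sym : ∀ {a b} → a ≡ b mod g → b ≡ a mod g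
  ≡-mod-sym {a} {b} (divides-difference g∣a-b) =
    from-divisible (negate-difference (+ a) (+ b)) (∣m⇒∣-m g∣a-b)
    where
    negate-difference : ∀ i j → ℤ.- (i ℤ.- j) ≡ j ℤ.- i
    negate-difference = solve-∀

  ≡-mod-trans : ∀ {a b c} → a ≡ b mod g → b ≡ c mod g → a ≡ c mod g
  ≡-mod-trans {a} {b} {c} (divides-difference g∣a-b) (divides-difference g∣b-c) =
    from-divisible (telescope (+ a) (+ b) (+ c)) (∣m∣n⇒∣m+n g∣a-b g∣b-c)
    where
    telescope : ∀ i j k → (i ℤ.- j) ℤ.+ (j ℤ.- k) ≡ i ℤ.- k
    telescope = solve-∀

  +-cong-mod : ∀ {a b c d} → a ≡ b mod g → c ≡ d mod g → a + c ≡ b + d mod g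
  +-cong-mod {a} {b} {c} {d} (divides-difference g∣a-b) (divides-difference g∣c-d) =
    from-divisible (regroup (+ a) (+ b) (+ c) (+ d)) (∣m∣n⇒∣m+n g∣a-b g∣c-d)
    where
    regroup : ∀ i j k l → (i ℤ.- j) ℤ.+ (k ℤ.- l) ≡ (i ℤ.+ k) ℤ.- (j ℤ.+ l)
    regroup = solve-∀

  ∣⇒≡0-mod : ∀ {a} → g ∣ a → a ≡ 0 mod g
  ∣⇒≡0-mod {a} g∣a = from-divisible (sym (cong +_ (+-identityʳ a))) (∣ᵤ⇒∣ g∣a)

  ≡-mod⇒∣∣-∣ : ∀ {a b} → a ≡ b mod g → g ∣ ∣ a - b ∣
  ≡-mod⇒∣∣-∣ {a} {b} (divides-difference g∣a-b) =
    subst (g ∣_) (trans (cong ℤ.∣_∣ ([+m]-[+n]≡m⊖n a b)) (∣⊖∣≡∣-∣ a b)) (∣⇒∣ᵤ g∣a-b)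

≡-mod-setoid : ℕ → Setoid _ _
≡-mod-setoid g = record
  { Carrier       = ℕ
  ; _≈_           = λ a b → a ≡ b mod g
  ; isEquivalence = record { refl = ≡-mod-refl ; sym = ≡-mod-sym ; trans = ≡-mod-trans }
  }

module _ {n : ℕ} {S T : ℕ → Set} {g t₀ : ℕ}
         (S≡-t₀ : ∀ {s} → S s → s + t₀ ≡ 0 mod g)
         (T≡t₀ : ∀ {t} → T t → t ≡ t₀ mod g) where

  open SetoidReasoning (≡-mod-setoid g)

  arc-lowers-by-t₀ : ∀ {u x} → Arc n S T u x → x + t₀ ≡ u mod g
  arc-lowers-by-t₀ {u} {x} (_ , _ , inj₁ (u<x , S[x-u])) = begin
    x + t₀              ≡⟨ cong (_+ t₀) (m+[n∸m]≡n (<⇒≤ u<x)) ⟨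
    u + (x ∸ u) + t₀    ≡⟨ +-assoc u (x ∸ u) t₀ ⟩
    u + (x ∸ u + t₀)    ≈⟨ +-cong-mod ≡-mod-refl (S≡-t₀ S[x-u]) ⟩
    u + 0               ≡⟨ +-identityʳ u ⟩
    u                   ∎
  arc-lowers-by-t₀ {u} {x} (_ , _ , inj₂ (x<u , T[u-x])) = begin
    x + t₀              ≈⟨ +-cong-mod ≡-mod-refl (≡-mod-sym (T≡t₀ T[u-x])) ⟩
    x + (u ∸ x)         ≡⟨ m+[n∸m]≡n (<⇒≤ x<u) ⟩
    u                   ∎

  walk-lowers-by-t₀ : ∀ {m u w} → Walk n S T m u w → w + m * t₀ ≡ u mod g
  walk-lowers-by-t₀ {w = w} (here _) = begin
    w + 0               ≡⟨ +-identityʳ w ⟩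
    w                   ∎
  walk-lowers-by-t₀ {suc m} {u} {w} (step {x = x} arc walk) = begin
    w + (t₀ + m * t₀)   ≡⟨ cong (λ k → w + k) (+-comm t₀ (m * t₀)) ⟩
    w + (m * t₀ + t₀)   ≡⟨ +-assoc w (m * t₀) t₀ ⟨
    w + m * t₀ + t₀     ≈⟨ +-cong-mod (walk-lowers-by-t₀ walk) ≡-mod-refl ⟩
    x + t₀              ≈⟨ arc-lowers-by-t₀ arc ⟩
    u                   ∎

  common-target⇒≡-mod : ∀ {m u v w} → Walk n S T m u w → Walk n S T m v w → u ≡ v mod g
  common-target⇒≡-mod u⇝w v⇝w =
    ≡-mod-trans (≡-mod-sym (walk-lowers-by-t₀ u⇝w)) (walk-lowers-by-t₀ v⇝w)

module _ {S T : ℕ → Set} {g : ℕ} (divides-sums : ∀ s t → S s → T t → g ∣ s + t) where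

  open SetoidReasoning (≡-mod-setoid g)

  sum≡0-mod : ∀ {s t₀} → S s → T t₀ → s + t₀ ≡ 0 mod g
  sum≡0-mod {s} {t₀} S-s T-t₀ = ∣⇒≡0-mod (divides-sums s t₀ S-s T-t₀)

  T-elements-≡-mod : ∀ {s₀ t₀ t} → S s₀ → T t₀ → T t → t ≡ t₀ mod g
  T-elements-≡-mod {s₀} {t₀} {t} S-s₀ T-t₀ T-t = begin
    t                   ≡⟨ +-identityʳ t ⟨
    t + 0               ≈⟨ +-cong-mod ≡-mod-refl (sum≡0-mod S-s₀ T-t₀) ⟨
    t + (s₀ + t₀)       ≡⟨ +-assoc t s₀ t₀ ⟨
    t + s₀ + t₀         ≡⟨ cong (_+ t₀) (+-comm t s₀) ⟩
    s₀ + t + t₀         ≈⟨ +-cong-mod (sum≡0-mod S-s₀ T-t) ≡-mod-refl ⟩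
    t₀                  ∎

theorem2p3 : (n : ℕ) → 2 ≤ n →
    (S T : ℕ → Set) →
    (∀ s → S s → 1 ≤ s × s ≤ n ∸ 1) →
    (∀ t → T t → 1 ≤ t × t ≤ n ∸ 1) →
    ∃ S → ∃ T →
    (m : ℕ) → 1 ≤ m →
    (u v : ℕ) → CompAdj n S T m u v →
    (g : ℕ) → IsGcdOfSums S T g →
    g ∣ ∣ u - v ∣
theorem2p3 _ _ S T _ _ (s₀ , S-s₀) (t₀ , T-t₀) _ _ u v (_ , _ , _ , _ , u⇝w , v⇝w) g (divides-sums , _) =
  ≡-mod⇒∣∣-∣ (common-target⇒≡-mod
    (λ S-s → sum≡0-mod divides-sums S-s T-t₀)
    (T-elements-≡-mod divides-sums S-s₀ T-t₀)
    u⇝w v⇝w)
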